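{- Let $\mathcal T$ be the intuitionistic set theory, in a first-order language with a binary relation symbol $\in$ and two constants $c,d$, whose only axioms are (C) $\forall a.\ a\in c\leftrightarrow a=c$ and (D) $\forall a.\ a\in d\leftrightarrow a\in c\land(a\in a\to a\in a)$, and let $\lambda\mathcal T$ be the lambda calculus corresponding to $\mathcal T$ (described in the context). There exist a formula $\phi$ and a $\lambda\mathcal T$ term $M$ such that $\vdash_{\mathcal T} M:\phi$ (empty context) and $M$ does not weakly normalize, i.e. there is no finite full reduction sequence from $M$ ending in a term that cannot be reduced further.
   Context: Logic: intuitionistic first-order logic without equality; $t=u$ abbreviates $\forall z.\ z\in t\leftrightarrow z\in u$, $\phi\leftrightarrow\psi$ abbreviates $(\phi\to\psi)\land(\psi\to\phi)$. The axioms (C) and (D) are treated as "class axioms" of the form $\forall a.\ a\in t_A\leftrightarrow\phi_A(a)$ with $t_C=c$, $\phi_C(a)= a=c$, and $t_D=d$ (viewed as a term with parameter $c$), $\phi_D(a)= a\in c\land(a\in a\to a\in a)$. $\lambda\mathcal T$ terms: $M::=x\mid M\,N\mid\lambda a.M\mid\lambda x:\phi.M\mid\mathrm{inl}(M)\mid\mathrm{inr}(M)\mid\mathrm{fst}(M)\mid\mathrm{snd}(M)\mid[t,M]\mid M\,t\mid\langle M,N\rangle\mid\mathrm{case}(M,x:\phi.N,x:\psi.O)\mid\mathrm{magic}(M)\mid\mathrm{let}\ [a,x:\phi]:=M\ \mathrm{in}\ N\mid\mathrm{cRep}(t,M)\mid\mathrm{cProp}(t,M)\mid\mathrm{dRep}(t,c,M)\mid\mathrm{dProp}(t,c,M)$.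 Typing: the natural-deduction rules of intuitionistic first-order logic annotated with these terms (variable; $\lambda x:\phi$/application for $\to$; pairing/fst/snd for $\land$; inl/inr/case for $\lor$; $\lambda a$ (eigenvariable condition)/$M\,t$ for $\forall$; $[t,M]$/let for $\exists$; magic for $\bot$), plus: from $M:\phi_C(t)$ infer $\mathrm{cRep}(t,M):t\in c$; from $M:t\in c$ infer $\mathrm{cProp}(t,M):\phi_C(t)$; from $M:\phi_D(t)$ infer $\mathrm{dRep}(t,c,M):t\in d$; from $M:t\in d$ infer $\mathrm{dProp}(t,c,M):\phi_D(t)$. Base reductions: $(\lambda x:\phi.M)N\to M[x:=N]$, $(\lambda a.M)t\to M[a:=t]$, $\mathrm{fst}\langle M,N\rangle\to M$, $\mathrm{snd}\langle M,N\rangle\to N$, $\mathrm{case}(\mathrm{inl}(M),x:\phi.N,x:\psi.O)\to N[x:=M]$, $\mathrm{case}(\mathrm{inr}(M),x:\phi.N,x:\psi.O)\to O[x:=M]$, $\mathrm{let}\ [a,x:\phi]:=[t,M]\ \mathrm{in}\ N\to N[a:=t][x:=M]$, $\mathrm{cProp}(t,\mathrm{cRep}(t,M))\to M$, $\mathrm{dProp}(t,c,\mathrm{dRep}(t,c,M))\to M$. Full reduction: base rules applied to any subterm. A term weakly normalizes if some full reduction path from it terminates. -}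

module Defs where

open import Data.Nat using (ℕ; zero; suc)
open import Data.List using (List; []; _∷_; map)
open import Data.Product using (Σ; _×_; _,_)
open import Relation.Nullary using (¬_)
open import Relation.Binary.Construct.Closure.ReflexiveTransitive using (Star)

data Tm : Set where
  var : ℕ → Tm
  𝐜   : Tm
  𝐝   : Tm

-- Formulas (bound term variables are de Bruijn indices).
data Fm : Set where
  _∈′_ : Tm → Tm → Fm
  ⊥′   : Fm
  _⇒_  : Fm → Fm → Fm
  _∧′_ : Fm → Fm → Fm
  _∨′_ : Fm → Fm → Fm
  ∀′   : Fm → Fm
  ∃′   : Fm → Fm

infixr 5 _⇒_
infixr 6 _∧′_ _∨′_
infix 8 _∈′_

TSub : Set
TSub = ℕ → Tm

substT : TSub → Tm → Tm
substT σ (var n) = σ n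
substT σ 𝐜 = 𝐜
substT σ 𝐝 = 𝐝

wkT : Tm → Tm
wkT = substT (λ n → var (suc n))

liftT : TSub → TSub
liftT σ zero    = var zero
liftT σ (suc n) = wkT (σ n)

substF : TSub → Fm → Fm
substF σ (t ∈′ u) = substT σ t ∈′ substT σ u
substF σ ⊥′ = ⊥′
substF σ (φ ⇒ ψ) = substF σ φ ⇒ substF σ ψ
substF σ (φ ∧′ ψ) = substF σ φ ∧′ substF σ ψ
substF σ (φ ∨′ ψ) = substF σ φ ∨′ substF σ ψ
substF σ (∀′ φ) = ∀′ (substF (liftT σ) φ)
substF σ (∃′ φ) = ∃′ (substF (liftT σ) φ)

wkF : Fm → Fm
wkF = substF (λ n → var (suc n))

sgT : Tm → TSub
sgT t zero    = t
sgT t (suc n) = var n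

_[_]F : Fm → Tm → Fm
φ [ t ]F = substF (sgT t) φ

_⇔_ : Fm → Fm → Fm
φ ⇔ ψ = (φ ⇒ ψ) ∧′ (ψ ⇒ φ)

-- t = u  abbreviates  ∀z. z ∈ t ↔ z ∈ u   (z fresh: de Bruijn 0)
_≐_ : Tm → Tm → Fm
t ≐ u = ∀′ ((var zero ∈′ wkT t) ⇔ (var zero ∈′ wkT u))

φC : Tm → Fm
φC t = t ≐ 𝐜

φD : Tm → Fm
φD t = (t ∈′ 𝐜) ∧′ ((t ∈′ t) ⇒ (t ∈′ t))

-- λ𝒯 proof terms (de Bruijn for both term variables and proof variables)
--   lamT M       = λa.M            (binds term var 0 in M)
--   lamP φ M     = λx:φ.M          (binds proof var 0 in M)
--   case M φ N ψ O = case(M, x:φ.N, x:ψ.O)  (binds proof var 0 in N, O)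
--   letE φ M N   = let [a,x:φ] := M in N   (binds term var 0 in φ and N,
--                                            proof var 0 in N)

data Pf : Set where
  pvar  : ℕ → Pf
  app   : Pf → Pf → Pf
  lamT  : Pf → Pf
  lamP  : Fm → Pf → Pf
  inl   : Pf → Pf
  inr   : Pf → Pf
  fst   : Pf → Pf
  snd   : Pf → Pf
  wit   : Tm → Pf → Pf
  appT  : Pf → Tm → Pf
  pair  : Pf → Pf → Pf
  case  : Pf → Fm → Pf → Fm → Pf → Pf
  magic : Pf → Pf
  letE  : Fm → Pf → Pf → Pf
  cRep  : Tm → Pf → Pf
  cProp : Tm → Pf → Pf
  dRep  : Tm → Tm → Pf → Pf
  dProp : Tm → Tm → Pf → Pf

substPT : TSub → Pf → Pf
substPT σ (pvar x) = pvar x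
substPT σ (app M N) = app (substPT σ M) (substPT σ N)
substPT σ (lamT M) = lamT (substPT (liftT σ) M)
substPT σ (lamP φ M) = lamP (substF σ φ) (substPT σ M)
substPT σ (inl M) = inl (substPT σ M)
substPT σ (inr M) = inr (substPT σ M)
substPT σ (fst M) = fst (substPT σ M)
substPT σ (snd M) = snd (substPT σ M)
substPT σ (wit t M) = wit (substT σ t) (substPT σ M)
substPT σ (appT M t) = appT (substPT σ M) (substT σ t)
substPT σ (pair M N) = pair (substPT σ M) (substPT σ N)
substPT σ (case M φ N ψ O) =
  case (substPT σ M) (substF σ φ) (substPT σ N) (substF σ ψ) (substPT σ O)
substPT σ (magic M) = magic (substPT σ M)
substPT σ (letE φ M N) =
  letE (substF (liftT σ) φ) (substPT σ M) (substPT (liftT σ) N)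
substPT σ (cRep t M) = cRep (substT σ t) (substPT σ M)
substPT σ (cProp t M) = cProp (substT σ t) (substPT σ M)
substPT σ (dRep t u M) = dRep (substT σ t) (substT σ u) (substPT σ M)
substPT σ (dProp t u M) = dProp (substT σ t) (substT σ u) (substPT σ M)

wkPT : Pf → Pf
wkPT = substPT (λ n → var (suc n))

liftR : (ℕ → ℕ) → ℕ → ℕ
liftR ρ zero    = zero
liftR ρ (suc n) = suc (ρ n)

renP : (ℕ → ℕ) → Pf → Pf
renP ρ (pvar x) = pvar (ρ x)
renP ρ (app M N) = app (renP ρ M) (renP ρ N)
renP ρ (lamT M) = lamT (renP ρ M)
renP ρ (lamP φ M) = lamP φ (renP (liftR ρ) M)
renP ρ (inl M) = inl (renP ρ M)
renP ρ (inr M) = inr (renP ρ M)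
renP ρ (fst M) = fst (renP ρ M)
renP ρ (snd M) = snd (renP ρ M)
renP ρ (wit t M) = wit t (renP ρ M)
renP ρ (appT M t) = appT (renP ρ M) t
renP ρ (pair M N) = pair (renP ρ M) (renP ρ N)
renP ρ (case M φ N ψ O) = case (renP ρ M) φ (renP (liftR ρ) N) ψ (renP (liftR ρ) O)
renP ρ (magic M) = magic (renP ρ M)
renP ρ (letE φ M N) = letE φ (renP ρ M) (renP (liftR ρ) N)
renP ρ (cRep t M) = cRep t (renP ρ M)
renP ρ (cProp t M) = cProp t (renP ρ M)
renP ρ (dRep t u M) = dRep t u (renP ρ M)
renP ρ (dProp t u M) = dProp t u (renP ρ M)

PSub : Set
PSub = ℕ → Pf

liftP : PSub → PSub
liftP σ zero    = pvar zero
liftP σ (suc n) = renP suc (σ n)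

-- going under a term-variable binder
liftPT : PSub → PSub
liftPT σ n = wkPT (σ n)

substP : PSub → Pf → Pf
substP σ (pvar x) = σ x
substP σ (app M N) = app (substP σ M) (substP σ N)
substP σ (lamT M) = lamT (substP (liftPT σ) M)
substP σ (lamP φ M) = lamP φ (substP (liftP σ) M)
substP σ (inl M) = inl (substP σ M)
substP σ (inr M) = inr (substP σ M)
substP σ (fst M) = fst (substP σ M)
substP σ (snd M) = snd (substP σ M)
substP σ (wit t M) = wit t (substP σ M)
substP σ (appT M t) = appT (substP σ M) t
substP σ (pair M N) = pair (substP σ M) (substP σ N)
substP σ (case M φ N ψ O) = case (substP σ M) φ (substP (liftP σ) N) ψ (substP (liftP σ) O)
substP σ (magic M) = magic (substP σ M)
substP σ (letE φ M N) = letE φ (substP σ M) (substP (liftP (liftPT σ)) N)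
substP σ (cRep t M) = cRep t (substP σ M)
substP σ (cProp t M) = cProp t (substP σ M)
substP σ (dRep t u M) = dRep t u (substP σ M)
substP σ (dProp t u M) = dProp t u (substP σ M)

sgP : Pf → PSub
sgP M zero    = M
sgP M (suc n) = pvar n

_[_]P : Pf → Pf → Pf
M [ N ]P = substP (sgP N) M

_[_]PT : Pf → Tm → Pf
M [ t ]PT = substPT (sgT t) M

Ctx : Set
Ctx = List Fm

data _∋_∶_ : Ctx → ℕ → Fm → Set where
  here  : ∀ {Γ φ} → (φ ∷ Γ) ∋ zero ∶ φ
  there : ∀ {Γ φ ψ n} → Γ ∋ n ∶ φ → (ψ ∷ Γ) ∋ suc n ∶ φ

infix 4 _∋_∶_ _⊢_∶_

data _⊢_∶_ : Ctx → Pf → Fm → Set where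
  ⊢var   : ∀ {Γ n φ} → Γ ∋ n ∶ φ → Γ ⊢ pvar n ∶ φ
  ⊢lamP  : ∀ {Γ φ ψ M} → (φ ∷ Γ) ⊢ M ∶ ψ → Γ ⊢ lamP φ M ∶ φ ⇒ ψ
  ⊢app   : ∀ {Γ φ ψ M N} → Γ ⊢ M ∶ φ ⇒ ψ → Γ ⊢ N ∶ φ → Γ ⊢ app M N ∶ ψ
  ⊢pair  : ∀ {Γ φ ψ M N} → Γ ⊢ M ∶ φ → Γ ⊢ N ∶ ψ → Γ ⊢ pair M N ∶ φ ∧′ ψ
  ⊢fst   : ∀ {Γ φ ψ M} → Γ ⊢ M ∶ φ ∧′ ψ → Γ ⊢ fst M ∶ φ
  ⊢snd   : ∀ {Γ φ ψ M} → Γ ⊢ M ∶ φ ∧′ ψ → Γ ⊢ snd M ∶ ψ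
  ⊢inl   : ∀ {Γ φ ψ M} → Γ ⊢ M ∶ φ → Γ ⊢ inl M ∶ φ ∨′ ψ
  ⊢inr   : ∀ {Γ φ ψ M} → Γ ⊢ M ∶ ψ → Γ ⊢ inr M ∶ φ ∨′ ψ
  ⊢case  : ∀ {Γ φ ψ ρ M N O} → Γ ⊢ M ∶ φ ∨′ ψ → (φ ∷ Γ) ⊢ N ∶ ρ → (ψ ∷ Γ) ⊢ O ∶ ρ
           → Γ ⊢ case M φ N ψ O ∶ ρ
  ⊢magic : ∀ {Γ φ M} → Γ ⊢ M ∶ ⊥′ → Γ ⊢ magic M ∶ φ
  -- eigenvariable condition: the bound variable is fresh (de Bruijn 0),
  -- all assumptions are shifted
  ⊢lamT  : ∀ {Γ φ M} → map wkF Γ ⊢ M ∶ φ → Γ ⊢ lamT M ∶ ∀′ φ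
  ⊢appT  : ∀ {Γ φ M} (t : Tm) → Γ ⊢ M ∶ ∀′ φ → Γ ⊢ appT M t ∶ φ [ t ]F
  ⊢wit   : ∀ {Γ φ M} (t : Tm) → Γ ⊢ M ∶ φ [ t ]F → Γ ⊢ wit t M ∶ ∃′ φ
  ⊢let   : ∀ {Γ φ ψ M N} → Γ ⊢ M ∶ ∃′ φ → (φ ∷ map wkF Γ) ⊢ N ∶ wkF ψ
           → Γ ⊢ letE φ M N ∶ ψ
  ⊢cRep  : ∀ {Γ M} (t : Tm) → Γ ⊢ M ∶ φC t → Γ ⊢ cRep t M ∶ t ∈′ 𝐜
  ⊢cProp : ∀ {Γ M} (t : Tm) → Γ ⊢ M ∶ t ∈′ 𝐜 → Γ ⊢ cProp t M ∶ φC t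
  ⊢dRep  : ∀ {Γ M} (t : Tm) → Γ ⊢ M ∶ φD t → Γ ⊢ dRep t 𝐜 M ∶ t ∈′ 𝐝
  ⊢dProp : ∀ {Γ M} (t : Tm) → Γ ⊢ M ∶ t ∈′ 𝐝 → Γ ⊢ dProp t 𝐜 M ∶ φD t

infix 4 _⟶_

data _⟶_ : Pf → Pf → Set where
  βP    : ∀ {φ M N} → app (lamP φ M) N ⟶ M [ N ]P
  βT    : ∀ {M t} → appT (lamT M) t ⟶ M [ t ]PT
  βfst  : ∀ {M N} → fst (pair M N) ⟶ M
  βsnd  : ∀ {M N} → snd (pair M N) ⟶ N
  βinl  : ∀ {M φ N ψ O} → case (inl M) φ N ψ O ⟶ N [ M ]P
  βinr  : ∀ {M φ N ψ O} → case (inr M) φ N ψ O ⟶ O [ M ]P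
  βlet  : ∀ {φ t M N} → letE φ (wit t M) N ⟶ (N [ t ]PT) [ M ]P
  βc    : ∀ {t M} → cProp t (cRep t M) ⟶ M
  βd    : ∀ {t u M} → dProp t u (dRep t u M) ⟶ M
  ξappˡ   : ∀ {M M′ N} → M ⟶ M′ → app M N ⟶ app M′ N
  ξappʳ   : ∀ {M N N′} → N ⟶ N′ → app M N ⟶ app M N′
  ξlamT   : ∀ {M M′} → M ⟶ M′ → lamT M ⟶ lamT M′
  ξlamP   : ∀ {φ M M′} → M ⟶ M′ → lamP φ M ⟶ lamP φ M′
  ξinl    : ∀ {M M′} → M ⟶ M′ → inl M ⟶ inl M′
  ξinr    : ∀ {M M′} → M ⟶ M′ → inr M ⟶ inr M′
  ξfst    : ∀ {M M′} → M ⟶ M′ → fst M ⟶ fst M′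
  ξsnd    : ∀ {M M′} → M ⟶ M′ → snd M ⟶ snd M′
  ξwit    : ∀ {t M M′} → M ⟶ M′ → wit t M ⟶ wit t M′
  ξappT   : ∀ {M M′ t} → M ⟶ M′ → appT M t ⟶ appT M′ t
  ξpairˡ  : ∀ {M M′ N} → M ⟶ M′ → pair M N ⟶ pair M′ N
  ξpairʳ  : ∀ {M N N′} → N ⟶ N′ → pair M N ⟶ pair M N′
  ξcase₁  : ∀ {M M′ φ N ψ O} → M ⟶ M′ → case M φ N ψ O ⟶ case M′ φ N ψ O
  ξcase₂  : ∀ {M φ N N′ ψ O} → N ⟶ N′ → case M φ N ψ O ⟶ case M φ N′ ψ O
  ξcase₃  : ∀ {M φ N ψ O O′} → O ⟶ O′ → case M φ N ψ O ⟶ case M φ N ψ O′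
  ξmagic  : ∀ {M M′} → M ⟶ M′ → magic M ⟶ magic M′
  ξletˡ   : ∀ {φ M M′ N} → M ⟶ M′ → letE φ M N ⟶ letE φ M′ N
  ξletʳ   : ∀ {φ M N N′} → N ⟶ N′ → letE φ M N ⟶ letE φ M N′
  ξcRep   : ∀ {t M M′} → M ⟶ M′ → cRep t M ⟶ cRep t M′
  ξcProp  : ∀ {t M M′} → M ⟶ M′ → cProp t M ⟶ cProp t M′
  ξdRep   : ∀ {t u M M′} → M ⟶ M′ → dRep t u M ⟶ dRep t u M′
  ξdProp  : ∀ {t u M M′} → M ⟶ M′ → dProp t u M ⟶ dProp t u M′

_⟶*_ : Pf → Pf → Set
_⟶*_ = Star _⟶_

Normal : Pf → Set
Normal M = ∀ N → ¬ (M ⟶ N)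

WN : Pf → Set
WN M = Σ Pf (λ N → (M ⟶* N) × Normal N)

-- Since a ∈ a → a ∈ a is provable, axiom (D) makes d extensionally equal to c,
-- so (C) yields d ∈ c. Then (D) unfolds d ∈ d to d ∈ c ∧ (d ∈ d → d ∈ d), which
-- lets us fold the Russell-style function δ = λx. snd(dProp x) x into a proof
-- of d ∈ d and apply δ to it: δ (dRep ⟨d∈c, δ⟩) reduces in three steps to
-- itself. All proper subterms are normal, so this cycle is the only reduction
-- path, and the term never reaches a normal form.
module Submission where

open import Defs
open import Data.List using ([])
open import Data.Nat using (zero)
open import Data.Product using (Σ; ∃; _×_; _,_)
open import Data.Empty using (⊥-elim)
open import Relation.Nullary using (¬_)
open import Relation.Binary.Construct.Closure.ReflexiveTransitive using (ε; _◅_)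

¬WN-of-closed : (P : Pf → Set)
              → (∀ {M N} → P M → M ⟶ N → P N)
              → (∀ {M} → P M → ∃ λ N → M ⟶ N)
              → ∀ {M} → P M → ¬ WN M
¬WN-of-closed P closed reducible pM (N , ε , normal) =
  let (N′ , step) = reducible pM in normal N′ step
¬WN-of-closed P closed reducible pM (N , step ◅ steps , normal) =
  ¬WN-of-closed P closed reducible (closed pM step) (N , steps , normal)

a : Tm
a = var zero

d⊆c : Pf
d⊆c = lamP (a ∈′ 𝐝) (fst (dProp a 𝐜 (pvar zero)))

c⊆d : Pf
c⊆d = lamP (a ∈′ 𝐜) (dRep a 𝐜 (pair (pvar zero) (lamP (a ∈′ a) (pvar zero))))

d∈c : Pf
d∈c = cRep 𝐝 (lamT (pair d⊆c c⊆d))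

δ : Pf
δ = lamP (𝐝 ∈′ 𝐝) (app (snd (dProp 𝐝 𝐜 (pvar zero))) (pvar zero))

d∈d : Pf
d∈d = dRep 𝐝 𝐜 (pair d∈c δ)

Ω : Pf
Ω = app δ d∈d

⊢d∈c : [] ⊢ d∈c ∶ 𝐝 ∈′ 𝐜
⊢d∈c = ⊢cRep 𝐝 (⊢lamT (⊢pair
  (⊢lamP (⊢fst (⊢dProp a (⊢var here))))
  (⊢lamP (⊢dRep a (⊢pair (⊢var here) (⊢lamP (⊢var here)))))))

⊢δ : [] ⊢ δ ∶ 𝐝 ∈′ 𝐝 ⇒ 𝐝 ∈′ 𝐝
⊢δ = ⊢lamP (⊢app (⊢snd (⊢dProp 𝐝 (⊢var here))) (⊢var here))

⊢d∈d : [] ⊢ d∈d ∶ 𝐝 ∈′ 𝐝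
⊢d∈d = ⊢dRep 𝐝 (⊢pair ⊢d∈c ⊢δ)

⊢Ω : [] ⊢ Ω ∶ 𝐝 ∈′ 𝐝
⊢Ω = ⊢app ⊢δ ⊢d∈d

d⊆c-normal : Normal d⊆c
d⊆c-normal _ (ξlamP (ξfst (ξdProp ())))

c⊆d-normal : Normal c⊆d
c⊆d-normal _ (ξlamP (ξdRep (ξpairˡ ())))
c⊆d-normal _ (ξlamP (ξdRep (ξpairʳ (ξlamP ()))))

d∈c-normal : Normal d∈c
d∈c-normal _ (ξcRep (ξlamT (ξpairˡ s))) = d⊆c-normal _ s
d∈c-normal _ (ξcRep (ξlamT (ξpairʳ s))) = c⊆d-normal _ s

δ-normal : Normal δ
δ-normal _ (ξlamP (ξappˡ (ξsnd (ξdProp ()))))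
δ-normal _ (ξlamP (ξappʳ ()))

d∈d-normal : Normal d∈d
d∈d-normal _ (ξdRep (ξpairˡ s)) = d∈c-normal _ s
d∈d-normal _ (ξdRep (ξpairʳ s)) = δ-normal _ s

data Ω-cycle : Pf → Set where
  Ω₀ : Ω-cycle Ω
  Ω₁ : Ω-cycle (app (snd (dProp 𝐝 𝐜 d∈d)) d∈d)
  Ω₂ : Ω-cycle (app (snd (pair d∈c δ)) d∈d)

Ω-cycle-closed : ∀ {M N} → Ω-cycle M → M ⟶ N → Ω-cycle N
Ω-cycle-closed Ω₀ βP                            = Ω₁
Ω-cycle-closed Ω₀ (ξappˡ s)                     = ⊥-elim (δ-normal _ s)
Ω-cycle-closed Ω₀ (ξappʳ s)                     = ⊥-elim (d∈d-normal _ s)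
Ω-cycle-closed Ω₁ (ξappˡ (ξsnd βd))             = Ω₂
Ω-cycle-closed Ω₁ (ξappˡ (ξsnd (ξdProp s)))     = ⊥-elim (d∈d-normal _ s)
Ω-cycle-closed Ω₁ (ξappʳ s)                     = ⊥-elim (d∈d-normal _ s)
Ω-cycle-closed Ω₂ (ξappˡ βsnd)                  = Ω₀
Ω-cycle-closed Ω₂ (ξappˡ (ξsnd (ξpairˡ s)))     = ⊥-elim (d∈c-normal _ s)
Ω-cycle-closed Ω₂ (ξappˡ (ξsnd (ξpairʳ s)))     = ⊥-elim (δ-normal _ s)
Ω-cycle-closed Ω₂ (ξappʳ s)                     = ⊥-elim (d∈d-normal _ s)

Ω-cycle-reducible : ∀ {M} → Ω-cycle M → ∃ λ N → M ⟶ N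
Ω-cycle-reducible Ω₀ = _ , βP
Ω-cycle-reducible Ω₁ = _ , ξappˡ (ξsnd βd)
Ω-cycle-reducible Ω₂ = _ , ξappˡ βsnd

theorem6p10 : Σ Fm (λ φ → Σ Pf (λ M → ([] ⊢ M ∶ φ) × ¬ WN M))
theorem6p10 =
  𝐝 ∈′ 𝐝 , Ω , ⊢Ω , ¬WN-of-closed Ω-cycle Ω-cycle-closed Ω-cycle-reducible Ω₀
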